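{- Neither the Next Fit Decreasing Height (NFDH) heuristic nor any Any Fit Decreasing Height (AFDH) heuristic has a constant approximation ratio for the square min-sum bin packing problem. That is, for every constant $c$ there is an instance $I$ with $\mathrm{ALG}(I) > c \cdot \mathrm{OPT}(I)$, where $\mathrm{ALG}(I)$ is the cost of the packing produced by the heuristic, with bins indexed in the order in which the heuristic opens them.
   Context: Square min-sum bin packing problem (SMSBPP): the input is a list of $n$ square items with sizes (side lengths) $s_1,\dots,s_n\in(0,1]$. The items must be packed, axis-parallel and without overlap of interiors, into indexed unit square bins $B_1,\dots,B_m$, each item lying entirely inside its bin. The cost of an item packed in $B_j$ is $j$, and the cost of a packing is $\sum_{j=1}^m j\cdot|B_j|$, where $|B_j|$ is the number of items in $B_j$. $\mathrm{OPT}(I)$ denotes the minimum cost over all feasible packings of instance $I$. Level-oriented heuristics: items are sorted in non-increasing order of size and packed into levels; a level is a horizontal strip spanning the width of the bin, whose height is the size of the first item placed in it, with items placed left to right on the level's base, and levels stacked bottom to top in a bin. NFDH: the current item is placed in the current level if it fits; otherwise a new level is opened above it in the current bin if it fits, and otherwise a new bin is opened; earlier levels and earlier bins never receive further items. AFDH (family of heuristics): a new level is opened only if the current item fits in none of the existing levels, and a new bin is opened only if the new level fits in none of the existing bins (the item/level being placed in some existing level/bin where it fits, according to the particular rule of the heuristic). -}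

module Defs where

open import Data.Nat using (ℕ; zero; suc) renaming (_+_ to _+ℕ_; _*_ to _*ℕ_)
open import Data.Fin using (Fin; zero; suc)
open import Data.List using (List; []; _∷_; _++_; [_]; length; lookup; map; allFin)
open import Data.Nat.ListAction using (sum)
open import Data.Product using (Σ; _×_; _,_)
open import Data.Sum using (_⊎_)
open import Data.Maybe using (Maybe; just; nothing)
open import Data.Bool using (Bool; true; false; if_then_else_)
open import Data.Rational using (ℚ; 0ℚ; 1ℚ; _+_; _≤_; _<_; _≤?_)
open import Relation.Nullary using (¬_; Dec; yes; no)
open import Relation.Nullary.Decidable using (⌊_⌋)
open import Relation.Binary.PropositionalEquality using (_≡_)

ValidInstance : List ℚ → Set
ValidInstance I = (i : Fin (length I)) → (0ℚ < lookup I i) × (lookup I i ≤ 1ℚ)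

-- Geometric packings (used for OPT).  A placement of an item is a bin
-- number b (meaning bin B_(b+1)) and the lower-left corner (x , y).

record Placement : Set where
  constructor place
  field
    bin : ℕ
    x   : ℚ
    y   : ℚ
open Placement public

Packing : List ℚ → Set
Packing I = Fin (length I) → Placement

Disjoint : ℚ → Placement → ℚ → Placement → Set
Disjoint s p t q =
  (x p + s ≤ x q) ⊎ (x q + t ≤ x p) ⊎ (y p + s ≤ y q) ⊎ (y q + t ≤ y p)

Feasible : (I : List ℚ) → Packing I → Set
Feasible I P =
  ((i : Fin (length I)) →
     (0ℚ ≤ x (P i)) × (x (P i) + lookup I i ≤ 1ℚ) ×
     (0ℚ ≤ y (P i)) × (y (P i) + lookup I i ≤ 1ℚ))
  × ((i j : Fin (length I)) → ¬ (i ≡ j) → bin (P i) ≡ bin (P j) →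
       Disjoint (lookup I i) (P i) (lookup I j) (P j))

-- cost = Σ_j j·|B_j| = Σ over items of the (1-based) bin index
packingCost : (I : List ℚ) → Packing I → ℕ
packingCost I P = sum (map (λ i → suc (bin (P i))) (allFin (length I)))

insertDesc : ℚ → List ℚ → List ℚ
insertDesc a [] = a ∷ []
insertDesc a (b ∷ bs) = if ⌊ b ≤? a ⌋ then a ∷ b ∷ bs else b ∷ insertDesc a bs

sortDesc : List ℚ → List ℚ
sortDesc [] = []
sortDesc (a ∷ as) = insertDesc a (sortDesc as)

-- Level-oriented packing states.  A bin is the list of its levels
-- (bottom to top, in opening order); the state is the list of bins in
-- the order in which they were opened.

record Level : Set where
  constructor lvl
  field
    height : ℚ   -- size of the first item of the level
    used   : ℚ
    count  : ℕ
open Level public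

Bin : Set
Bin = List Level

State : Set
State = List Bin

levelFits : ℚ → Level → Bool
levelFits s L = ⌊ s ≤? height L ⌋ ∧' ⌊ used L + s ≤? 1ℚ ⌋
  where
  _∧'_ : Bool → Bool → Bool
  true ∧' b = b
  false ∧' _ = false

binHeight : Bin → ℚ
binHeight [] = 0ℚ
binHeight (L ∷ Ls) = height L + binHeight Ls

binFits : ℚ → Bin → Bool
binFits s b = ⌊ binHeight b + s ≤? 1ℚ ⌋

addItem : ℚ → Level → Level
addItem s (lvl h w k) = lvl h (w + s) (suc k)

newLevel : ℚ → Level
newLevel s = lvl s s 1

modifyAt : {A : Set} → ℕ → (A → A) → List A → List A
modifyAt _ f [] = []
modifyAt zero f (a ∷ as) = f a ∷ as
modifyAt (suc n) f (a ∷ as) = a ∷ modifyAt n f as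

binCount : Bin → ℕ
binCount [] = 0
binCount (L ∷ Ls) = count L +ℕ binCount Ls

stateCostFrom : ℕ → State → ℕ
stateCostFrom j [] = 0
stateCostFrom j (b ∷ bs) = j *ℕ binCount b +ℕ stateCostFrom (suc j) bs

stateCost : State → ℕ
stateCost = stateCostFrom 1

-- NFDH: only the current level of the current (last) bin may receive
-- the item; otherwise a new level is opened on top of the current bin
-- if it fits; otherwise a new bin is opened.

addToLastLevel : ℚ → Bin → Maybe Bin
addToLastLevel s [] = nothing
addToLastLevel s (L ∷ []) = if levelFits s L then just (addItem s L ∷ []) else nothing
addToLastLevel s (L ∷ L' ∷ Ls) with addToLastLevel s (L' ∷ Ls)
... | just b' = just (L ∷ b')
... | nothing = nothing

nfdhPlaceInBin : ℚ → Bin → Maybe Bin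
nfdhPlaceInBin s b with addToLastLevel s b
... | just b' = just b'
... | nothing = if binFits s b then just (b ++ [ newLevel s ]) else nothing

nfdhStep : State → ℚ → State
nfdhStep [] s = [ [ newLevel s ] ]
nfdhStep (b ∷ []) s with nfdhPlaceInBin s b
... | just b' = [ b' ]
... | nothing = b ∷ [ [ newLevel s ] ]
nfdhStep (b ∷ b' ∷ bs) s = b ∷ nfdhStep (b' ∷ bs) s

runFrom : (State → ℚ → State) → State → List ℚ → State
runFrom step st [] = st
runFrom step st (s ∷ ss) = runFrom step (step st s) ss

NFDH : List ℚ → ℕ
NFDH I = stateCost (runFrom nfdhStep [] (sortDesc I))

-- AFDH family.  Positions: (bin index , level index), 0-based, in
-- opening order.

indexed : {A : Set} → ℕ → List A → List (ℕ × A)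
indexed n [] = []
indexed n (a ∷ as) = (n , a) ∷ indexed (suc n) as

filterB : {A : Set} → (A → Bool) → List A → List A
filterB p [] = []
filterB p (a ∷ as) = if p a then a ∷ filterB p as else filterB p as

concatL : {A : Set} → List (List A) → List A
concatL [] = []
concatL (xs ∷ xss) = xs ++ concatL xss

levelCands : State → ℚ → List (ℕ × ℕ)
levelCands st s =
  concatL (map (λ { (i , b) →
    map (λ { (k , _) → (i , k) })
        (filterB (λ { (_ , L) → levelFits s L }) (indexed 0 b)) })
    (indexed 0 st))

binCands : State → ℚ → List ℕ
binCands st s =
  map (λ { (i , _) → i }) (filterB (λ { (_ , b) → binFits s b }) (indexed 0 st))

-- a particular AFDH heuristic is given by its rule for choosing among
-- the (nonempty list of) fitting levels, resp. fitting bins; the choice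
-- may depend on the current state and the current item.
record AFDHRule : Set where
  field
    chooseLevel : State → ℚ → (c : ℕ × ℕ) → (cs : List (ℕ × ℕ)) → Fin (length (c ∷ cs))
    chooseBin   : State → ℚ → (c : ℕ) → (cs : List ℕ) → Fin (length (c ∷ cs))
open AFDHRule public

afdhNewLevel : AFDHRule → State → ℚ → State
afdhNewLevel r st s with binCands st s
... | [] = st ++ [ [ newLevel s ] ]
... | c ∷ cs = modifyAt (lookup (c ∷ cs) (chooseBin r st s c cs)) (λ b → b ++ [ newLevel s ]) st

afdhStep : AFDHRule → State → ℚ → State
afdhStep r st s with levelCands st s
... | [] = afdhNewLevel r st s
... | c ∷ cs with lookup (c ∷ cs) (chooseLevel r st s c cs)
...   | (i , k) = modifyAt i (modifyAt k (addItem s)) st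

AFDH : AFDHRule → List ℚ → ℕ
AFDH r I = stateCost (runFrom (afdhStep r) [] (sortDesc I))

-- Both heuristics put each of k unit items into a bin of its own and then
-- place the m items of size 1/m side by side on one level of bin k+1, at
-- cost (k+1)·m.  Placing the small items into the first bin instead and the
-- unit items into bins 2, …, k+1 costs at most m + k(k+1); hence the ratio
-- exceeds c as soon as m > c·k(k+1), and we take k = c.
module Submission where

open import Defs
open import Data.Nat using (ℕ; _*_; _<_)
open import Data.List using (List)
open import Data.Rational using (ℚ)
open import Data.Product using (Σ; _×_)

open import Data.Nat using (zero; suc; _+_; _≤_; _∸_; z≤n; s≤s; z<s; s<s)
import Data.Nat.Properties as ℕ
open import Data.Nat.ListAction using (sum)
open import Data.Nat.ListAction.Properties using (sum-++)
open import Data.Fin using (toℕ) renaming (zero to fzero; suc to fsuc)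
import Data.Fin.Properties as Fin
open import Data.List
  using ([]; _∷_; _++_; [_]; head; replicate; length; lookup; map; tabulate; applyUpTo; allFin)
import Data.List.Properties as List
import Data.List.Relation.Unary.All as All
import Data.List.Relation.Unary.All.Properties as All
open import Data.List.Relation.Unary.Linked using (Linked; []; [-]; _∷_; _∷′_)
open import Data.List.Membership.Propositional.Properties using (∈-lookup)
open import Data.Maybe using (just)
open import Data.Maybe.Relation.Binary.Connected using (Connected) renaming (just to connected)
open import Data.Product using (_,_)
open import Data.Sum using (inj₁; inj₂)
open import Data.Bool using (Bool; true; false; if_then_else_)
open import Data.Rational
  using (0ℚ; 1ℚ; _≤?_; 1/_; positive; Positive; NonZero)
  renaming (_≤_ to _≤ℚ_; _<_ to _<ℚ_; _+_ to _+ℚ_; _*_ to _*ℚ_)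
import Data.Rational.Properties as ℚ
open import Algebra.Properties.Monoid.Mult.TCOptimised ℚ.+-0-monoid
  using (1+×; ×-homo-+) renaming (_×_ to _·_)
open import Function using (_∘_)
open import Relation.Binary.Definitions using (tri<; tri≈; tri>)
open import Relation.Nullary using (¬_; Dec; yes; no; contradiction)
open import Relation.Nullary.Decidable using (isYes; isYes≗does; dec-false)
open import Relation.Binary.PropositionalEquality hiding ([_])

·-nonNeg : ∀ n {x} → 0ℚ ≤ℚ x → 0ℚ ≤ℚ n · x
·-nonNeg zero        0≤x = ℚ.≤-refl
·-nonNeg (suc n) {x} 0≤x = subst (0ℚ ≤ℚ_) (sym (1+× n x)) (ℚ.+-mono-≤ 0≤x (·-nonNeg n 0≤x))

·-suc : ∀ n x → suc n · x ≡ n · x +ℚ x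
·-suc n x = trans (cong (_· x) (ℕ.+-comm 1 n)) (×-homo-+ x n 1)

·-monoˡ-≤ : ∀ {m n x} → 0ℚ ≤ℚ x → m ≤ n → m · x ≤ℚ n · x
·-monoˡ-≤ {m} {n} {x} 0≤x m≤n = begin
  m · x                 ≡⟨ ℚ.+-identityʳ (m · x) ⟨
  m · x +ℚ 0ℚ           ≤⟨ ℚ.+-monoʳ-≤ (m · x) (·-nonNeg (n ∸ m) 0≤x) ⟩
  m · x +ℚ (n ∸ m) · x  ≡⟨ ×-homo-+ x m (n ∸ m) ⟨
  (m + (n ∸ m)) · x     ≡⟨ cong (_· x) (ℕ.m+[n∸m]≡n m≤n) ⟩
  n · x                 ∎
  where open ℚ.≤-Reasoning

m<n⇒m·x+x≤n·x : ∀ {m n x} → 0ℚ ≤ℚ x → m < n → m · x +ℚ x ≤ℚ n · x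
m<n⇒m·x+x≤n·x {m} {n} {x} 0≤x m<n = subst (_≤ℚ n · x) (·-suc m x) (·-monoˡ-≤ 0≤x m<n)

·-pos : ∀ n {x} → 0ℚ <ℚ x → 0ℚ <ℚ suc n · x
·-pos n 0<x = ℚ.<-≤-trans 0<x (·-monoˡ-≤ {1} {suc n} (ℚ.<⇒≤ 0<x) (s≤s z≤n))

·-*-assoc : ∀ n x y → n · x *ℚ y ≡ n · (x *ℚ y)
·-*-assoc zero    x y = ℚ.*-zeroˡ y
·-*-assoc (suc n) x y = begin
  suc n · x *ℚ y             ≡⟨ cong (_*ℚ y) (·-suc n x) ⟩
  (n · x +ℚ x) *ℚ y          ≡⟨ ℚ.*-distribʳ-+ y (n · x) x ⟩
  n · x *ℚ y +ℚ x *ℚ y       ≡⟨ cong (_+ℚ x *ℚ y) (·-*-assoc n x y) ⟩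
  n · (x *ℚ y) +ℚ x *ℚ y     ≡⟨ ·-suc n (x *ℚ y) ⟨
  suc n · (x *ℚ y)           ∎
  where open ≡-Reasoning

suc·1-positive : ∀ n → Positive (suc n · 1ℚ)
suc·1-positive n = positive (·-pos n (ℚ.positive⁻¹ 1ℚ))

suc·1-nonZero : ∀ n → NonZero (suc n · 1ℚ)
suc·1-nonZero n = ℚ.pos⇒nonZero (suc n · 1ℚ) {{suc·1-positive n}}

1/suc : ℕ → ℚ
1/suc n = (1/ (suc n · 1ℚ)) {{suc·1-nonZero n}}

1/suc-pos : ∀ n → 0ℚ <ℚ 1/suc n
1/suc-pos n = ℚ.positive⁻¹ (1/suc n) {{ℚ.1/pos⇒pos (suc n · 1ℚ) {{suc·1-positive n}}}}

·-1/suc : ∀ n → suc n · 1/suc n ≡ 1ℚ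
·-1/suc n = begin
  suc n · 1/suc n            ≡⟨ cong (suc n ·_) (ℚ.*-identityˡ (1/suc n)) ⟨
  suc n · (1ℚ *ℚ 1/suc n)    ≡⟨ ·-*-assoc (suc n) 1ℚ (1/suc n) ⟨
  suc n · 1ℚ *ℚ 1/suc n      ≡⟨ ℚ.*-inverseʳ (suc n · 1ℚ) {{suc·1-nonZero n}} ⟩
  1ℚ                         ∎
  where open ≡-Reasoning

insertDesc-≥ : ∀ {a b} bs → b ≤ℚ a → insertDesc a (b ∷ bs) ≡ a ∷ b ∷ bs
insertDesc-≥ {a} {b} _ b≤a with b ≤? a
... | yes _  = refl
... | no b≰a = contradiction b≤a b≰a

sortDesc-nonIncreasing : ∀ {xs} → Linked (λ a b → b ≤ℚ a) xs → sortDesc xs ≡ xs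
sortDesc-nonIncreasing []  = refl
sortDesc-nonIncreasing [-] = refl
sortDesc-nonIncreasing {a ∷ b ∷ bs} (b≤a ∷ sorted)
  rewrite sortDesc-nonIncreasing sorted = insertDesc-≥ bs b≤a

module _ {A : Set} {R : A → A → Set} {x : A} (Rxx : R x x) where

  replicate⁺ : ∀ n → Linked R (replicate n x)
  replicate⁺ zero          = []
  replicate⁺ (suc zero)    = [-]
  replicate⁺ (suc (suc n)) = Rxx ∷ replicate⁺ (suc n)

  replicate-++⁺ : ∀ n {ys} → Connected R (just x) (head ys) → Linked R ys →
                  Linked R (replicate n x ++ ys)
  replicate-++⁺ zero          _ ys↗ = ys↗
  replicate-++⁺ (suc zero)    c ys↗ = c ∷′ ys↗
  replicate-++⁺ (suc (suc n)) c ys↗ = Rxx ∷ replicate-++⁺ (suc n) c ys↗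

-- Where the j-th entry of a list  replicate k a ++ ys  comes from.
data Block (k : ℕ) : ℕ → Set where
  first  : ∀ {j} → j < k → Block k j
  second : ∀ m → Block k (k + m)

block : ∀ k j → Block k j
block zero    j       = second j
block (suc k) zero    = first z<s
block (suc k) (suc j) with block k j
... | first j<k = first (s<s j<k)
... | second m  = second m

block-+ : ∀ k m → block k (k + m) ≡ second m
block-+ zero    m = refl
block-+ (suc k) m rewrite block-+ k m = refl

blockwise : ∀ {A : Set} {k j} → A → A → Block k j → A
blockwise a b (first _)  = a
blockwise a b (second _) = b

lookup-replicate : ∀ {A : Set} n (x : A) i → lookup (replicate n x) i ≡ x
lookup-replicate (suc n) x fzero    = refl
lookup-replicate (suc n) x (fsuc i) = lookup-replicate n x i

lookup-replicate-++ : ∀ {A : Set} k (a b : A) n i →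
  lookup (replicate k a ++ replicate n b) i ≡ blockwise a b (block k (toℕ i))
lookup-replicate-++ zero    a b n i        = lookup-replicate n b i
lookup-replicate-++ (suc k) a b n fzero    = refl
lookup-replicate-++ (suc k) a b n (fsuc i)
  with toℕ i | block k (toℕ i) | lookup-replicate-++ k a b n i
... | _ | first _  | eq = eq
... | _ | second _ | eq = eq

tabulate-∘toℕ : ∀ {A : Set} n (f : ℕ → A) → tabulate {n = n} (f ∘ toℕ) ≡ applyUpTo f n
tabulate-∘toℕ zero    f = refl
tabulate-∘toℕ (suc n) f = cong (f 0 ∷_) (tabulate-∘toℕ n (f ∘ suc))

map-∘toℕ-allFin : ∀ {A : Set} n (f : ℕ → A) → map (f ∘ toℕ) (allFin n) ≡ applyUpTo f n
map-∘toℕ-allFin n f = trans (List.map-tabulate {n = n} (λ i → i) (f ∘ toℕ)) (tabulate-∘toℕ n f)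

applyUpTo-+ : ∀ {A : Set} (f : ℕ → A) m n →
  applyUpTo f (m + n) ≡ applyUpTo f m ++ applyUpTo (f ∘ (m +_)) n
applyUpTo-+ f zero    n = refl
applyUpTo-+ f (suc m) n = cong (f 0 ∷_) (applyUpTo-+ (f ∘ suc) m n)

sum-applyUpTo-≤ : ∀ (f : ℕ → ℕ) n {c} → (∀ j → f j ≤ c) → sum (applyUpTo f n) ≤ n * c
sum-applyUpTo-≤ f zero    f≤c = z≤n
sum-applyUpTo-≤ f (suc n) f≤c = ℕ.+-mono-≤ (f≤c 0) (sum-applyUpTo-≤ (f ∘ suc) n (f≤c ∘ suc))

isYes-false : ∀ {A : Set} (a? : Dec A) → ¬ A → isYes a? ≡ false
isYes-false a? ¬a = trans (isYes≗does a?) (dec-false a? ¬a)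

if-true : ∀ {A : Set} {b} {x y : A} → b ≡ true → (if b then x else y) ≡ x
if-true refl = refl

if-false : ∀ {A : Set} {b} {x y : A} → b ≡ false → (if b then x else y) ≡ y
if-false refl = refl

fullLevel : Level
fullLevel = newLevel 1ℚ

fullBin : Bin
fullBin = [ fullLevel ]

fullBins : ℕ → State
fullBins n = replicate n fullBin

copiesLevel : ℚ → ℕ → Level
copiesLevel t n = lvl t (n · t) n

1+s≰1 : ∀ {s} → 0ℚ <ℚ s → ¬ (1ℚ +ℚ s ≤ℚ 1ℚ)
1+s≰1 {s} 0<s 1+s≤1 = ℚ.<-irrefl refl (ℚ.<-≤-trans 1<1+s 1+s≤1)
  where
  1<1+s : 1ℚ <ℚ 1ℚ +ℚ s
  1<1+s = subst (_<ℚ 1ℚ +ℚ s) (ℚ.+-identityʳ 1ℚ) (ℚ.+-monoʳ-< 1ℚ 0<s)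

levelFits-full : ∀ {s} → 0ℚ <ℚ s → levelFits s fullLevel ≡ false
levelFits-full {s} 0<s with s ≤? 1ℚ
... | yes _ = isYes-false (1ℚ +ℚ s ≤? 1ℚ) (1+s≰1 0<s)
... | no _  = refl

binFits-full : ∀ {s} → 0ℚ <ℚ s → binFits s fullBin ≡ false
binFits-full {s} 0<s = isYes-false (1ℚ +ℚ 0ℚ +ℚ s ≤? 1ℚ) (1+s≰1 0<s)

levelFits-copies : ∀ {t} n → suc (suc n) · t ≤ℚ 1ℚ → levelFits t (copiesLevel t (suc n)) ≡ true
levelFits-copies {t} n fits with t ≤? t | suc n · t +ℚ t ≤? 1ℚ
... | yes _  | yes _    = refl
... | no t≰t | _        = contradiction ℚ.≤-refl t≰t
... | yes _  | no ¬fits = contradiction fits ¬fits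

nfdhStep-++ : ∀ bs b s → nfdhStep (bs ++ [ b ]) s ≡ bs ++ nfdhStep [ b ] s
nfdhStep-++ []             b s = refl
nfdhStep-++ (b′ ∷ [])      b s = refl
nfdhStep-++ (b′ ∷ b″ ∷ bs) b s = cong (b′ ∷_) (nfdhStep-++ (b″ ∷ bs) b s)

nfdhStep-fullBins : ∀ j {s} → 0ℚ <ℚ s → nfdhStep (fullBins j) s ≡ fullBins j ++ [ [ newLevel s ] ]
nfdhStep-fullBins zero          0<s = refl
nfdhStep-fullBins (suc zero)    0<s rewrite levelFits-full 0<s | binFits-full 0<s = refl
nfdhStep-fullBins (suc (suc j)) 0<s = cong (fullBin ∷_) (nfdhStep-fullBins (suc j) 0<s)

nfdhStep-fits : ∀ bs {s} L → levelFits s L ≡ true →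
  nfdhStep (bs ++ [ [ L ] ]) s ≡ bs ++ [ [ addItem s L ] ]
nfdhStep-fits bs {s} L fits rewrite nfdhStep-++ bs [ L ] s | fits = refl

module _ {A : Set} (f : ℕ × Bin → List A) (f-full : ∀ n → f (n , fullBin) ≡ []) where

  concatL-skipFullBins : ∀ j n bs →
    concatL (map f (indexed n (fullBins j ++ bs))) ≡ concatL (map f (indexed (n + j) bs))
  concatL-skipFullBins zero    n bs =
    cong (λ m → concatL (map f (indexed m bs))) (sym (ℕ.+-identityʳ n))
  concatL-skipFullBins (suc j) n bs rewrite f-full n =
    trans (concatL-skipFullBins j (suc n) bs)
          (cong (λ m → concatL (map f (indexed m bs))) (sym (ℕ.+-suc n j)))

filterB-skipFullBins : (p : ℕ × Bin → Bool) → (∀ n → p (n , fullBin) ≡ false) → ∀ j n bs →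
  filterB p (indexed n (fullBins j ++ bs)) ≡ filterB p (indexed (n + j) bs)
filterB-skipFullBins p p-full zero    n bs =
  cong (λ m → filterB p (indexed m bs)) (sym (ℕ.+-identityʳ n))
filterB-skipFullBins p p-full (suc j) n bs rewrite p-full n =
  trans (filterB-skipFullBins p p-full j (suc n) bs)
        (cong (λ m → filterB p (indexed m bs)) (sym (ℕ.+-suc n j)))

levelCands-fullBins : ∀ j {s} → 0ℚ <ℚ s → levelCands (fullBins j) s ≡ []
levelCands-fullBins j {s} 0<s =
  trans (cong (λ st → levelCands st s) (sym (List.++-identityʳ (fullBins j))))
        (concatL-skipFullBins _ (λ _ → cong (map _) (if-false (levelFits-full 0<s))) j 0 [])

binCands-fullBins : ∀ j {s} → 0ℚ <ℚ s → binCands (fullBins j) s ≡ []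
binCands-fullBins j {s} 0<s =
  trans (cong (λ st → binCands st s) (sym (List.++-identityʳ (fullBins j))))
        (cong (map _) (filterB-skipFullBins _ (λ _ → binFits-full 0<s) j 0 []))

levelCands-fits : ∀ j {s} L → 0ℚ <ℚ s → levelFits s L ≡ true →
  levelCands (fullBins j ++ [ [ L ] ]) s ≡ [ (j , 0) ]
levelCands-fits j L 0<s fits =
  trans (concatL-skipFullBins _ (λ _ → cong (map _) (if-false (levelFits-full 0<s))) j 0 [ [ L ] ])
        (cong (λ ls → map _ ls ++ []) (if-true fits))

modifyAt-replicate-++ : ∀ {A : Set} k (x y : A) ys f →
  modifyAt k f (replicate k x ++ y ∷ ys) ≡ replicate k x ++ f y ∷ ys
modifyAt-replicate-++ zero    x y ys f = refl
modifyAt-replicate-++ (suc k) x y ys f = cong (x ∷_) (modifyAt-replicate-++ k x y ys f)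

afdhStep-fullBins : ∀ r j {s} → 0ℚ <ℚ s → afdhStep r (fullBins j) s ≡ fullBins j ++ [ [ newLevel s ] ]
afdhStep-fullBins r j 0<s rewrite levelCands-fullBins j 0<s | binCands-fullBins j 0<s = refl

afdhStep-fits : ∀ r j {s} L → 0ℚ <ℚ s → levelFits s L ≡ true →
  afdhStep r (fullBins j ++ [ [ L ] ]) s ≡ fullBins j ++ [ [ addItem s L ] ]
afdhStep-fits r j {s} L 0<s fits rewrite levelCands-fits j L 0<s fits
  with chooseLevel r (fullBins j ++ [ [ L ] ]) s (j , 0) []
... | fzero = modifyAt-replicate-++ j fullBin [ L ] [] (modifyAt 0 (addItem s))

-- All the argument needs to know about a heuristic: how it acts on states in
-- which every bin is full except possibly a last one consisting of one level.
record NextFitOnFullBins (step : State → ℚ → State) : Set where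
  field
    opensBin   : ∀ j {s} → 0ℚ <ℚ s → step (fullBins j) s ≡ fullBins j ++ [ [ newLevel s ] ]
    fillsLevel : ∀ j {s} L → 0ℚ <ℚ s → levelFits s L ≡ true →
                 step (fullBins j ++ [ [ L ] ]) s ≡ fullBins j ++ [ [ addItem s L ] ]

nfdhStep-nextFit : NextFitOnFullBins nfdhStep
nfdhStep-nextFit = record
  { opensBin   = nfdhStep-fullBins
  ; fillsLevel = λ j L _ → nfdhStep-fits (fullBins j) L
  }

afdhStep-nextFit : ∀ r → NextFitOnFullBins (afdhStep r)
afdhStep-nextFit r = record
  { opensBin   = afdhStep-fullBins r
  ; fillsLevel = afdhStep-fits r
  }

runFrom-++ : ∀ step st xs ys → runFrom step st (xs ++ ys) ≡ runFrom step (runFrom step st xs) ys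
runFrom-++ step st []       ys = refl
runFrom-++ step st (x ∷ xs) ys = runFrom-++ step (step st x) xs ys

replicate-∷ʳ : ∀ {A : Set} n (x : A) → replicate n x ++ [ x ] ≡ replicate (suc n) x
replicate-∷ʳ zero    x = refl
replicate-∷ʳ (suc n) x = cong (x ∷_) (replicate-∷ʳ n x)

module _ {step} (nextFit : NextFitOnFullBins step) where
  open NextFitOnFullBins nextFit

  runFrom-units : ∀ n → runFrom step [] (replicate n 1ℚ) ≡ fullBins n
  runFrom-units zero    = refl
  runFrom-units (suc n) = begin
    runFrom step [] (replicate (suc n) 1ℚ)       ≡⟨ cong (runFrom step []) (replicate-∷ʳ n 1ℚ) ⟨
    runFrom step [] (replicate n 1ℚ ++ [ 1ℚ ])   ≡⟨ runFrom-++ step [] (replicate n 1ℚ) [ 1ℚ ] ⟩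
    step (runFrom step [] (replicate n 1ℚ)) 1ℚ   ≡⟨ cong (λ st → step st 1ℚ) (runFrom-units n) ⟩
    step (fullBins n) 1ℚ                         ≡⟨ opensBin n (ℚ.positive⁻¹ 1ℚ) ⟩
    fullBins n ++ [ fullBin ]                    ≡⟨ replicate-∷ʳ n fullBin ⟩
    fullBins (suc n)                             ∎
    where open ≡-Reasoning

  runFrom-copies : ∀ {t} → 0ℚ <ℚ t → ∀ k n → suc n · t ≤ℚ 1ℚ →
    runFrom step (fullBins k) (replicate (suc n) t) ≡ fullBins k ++ [ [ copiesLevel t (suc n) ] ]
  runFrom-copies 0<t k zero    _    = opensBin k 0<t
  runFrom-copies {t} 0<t k (suc n) fits = begin
    runFrom step (fullBins k) (replicate (suc (suc n)) t)
      ≡⟨ cong (runFrom step (fullBins k)) (replicate-∷ʳ (suc n) t) ⟨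
    runFrom step (fullBins k) (replicate (suc n) t ++ [ t ])
      ≡⟨ runFrom-++ step (fullBins k) (replicate (suc n) t) [ t ] ⟩
    step (runFrom step (fullBins k) (replicate (suc n) t)) t
      ≡⟨ cong (λ st → step st t) (runFrom-copies 0<t k n fits′) ⟩
    step (fullBins k ++ [ [ copiesLevel t (suc n) ] ]) t
      ≡⟨ fillsLevel k (copiesLevel t (suc n)) 0<t (levelFits-copies n fits) ⟩
    fullBins k ++ [ [ copiesLevel t (suc (suc n)) ] ]
      ∎
    where
    open ≡-Reasoning
    fits′ : suc n · t ≤ℚ 1ℚ
    fits′ = ℚ.≤-trans (·-monoˡ-≤ {suc n} {suc (suc n)} (ℚ.<⇒≤ 0<t) (ℕ.n≤1+n (suc n))) fits

stateCostFrom-fullBins : ∀ n j b → (n + j) * binCount b ≤ stateCostFrom j (fullBins n ++ [ b ])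
stateCostFrom-fullBins zero    j b = ℕ.m≤m+n (j * binCount b) 0
stateCostFrom-fullBins (suc n) j b = begin
  (suc n + j) * binCount b                    ≡⟨ cong (_* binCount b) (ℕ.+-suc n j) ⟨
  (n + suc j) * binCount b                    ≤⟨ stateCostFrom-fullBins n (suc j) b ⟩
  stateCostFrom (suc j) (fullBins n ++ [ b ]) ≤⟨ ℕ.m≤n+m _ (j * binCount fullBin) ⟩
  stateCostFrom j (fullBins (suc n) ++ [ b ]) ∎
  where open ℕ.≤-Reasoning

module HardInstance (k n : ℕ) {t : ℚ} (0<t : 0ℚ <ℚ t) (fits : suc n · t ≤ℚ 1ℚ) where

  I : List ℚ
  I = replicate k 1ℚ ++ replicate (suc n) t

  0≤t : 0ℚ ≤ℚ t
  0≤t = ℚ.<⇒≤ 0<t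

  t≤1 : t ≤ℚ 1ℚ
  t≤1 = ℚ.≤-trans (·-monoˡ-≤ {1} {suc n} 0≤t (s≤s z≤n)) fits

  valid : ValidInstance I
  valid i = All.lookup {P = λ s → (0ℚ <ℚ s) × (s ≤ℚ 1ℚ)}
    (All.++⁺ (All.replicate⁺ k (ℚ.positive⁻¹ 1ℚ , ℚ.≤-refl)) (All.replicate⁺ (suc n) (0<t , t≤1)))
    (∈-lookup i)

  sortDesc-I : sortDesc I ≡ I
  sortDesc-I = sortDesc-nonIncreasing
    (replicate-++⁺ ℚ.≤-refl k (connected t≤1) (replicate⁺ ℚ.≤-refl (suc n)))

  heuristic-cost : ∀ {step} → NextFitOnFullBins step →
    suc k * suc n ≤ stateCost (runFrom step [] (sortDesc I))
  heuristic-cost {step} nextFit = begin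
    suc k * suc n                                           ≡⟨ cong₂ _*_ (ℕ.+-comm k 1) (ℕ.+-identityʳ (suc n)) ⟨
    (k + 1) * (suc n + 0)                                   ≤⟨ stateCostFrom-fullBins k 1 [ copiesLevel t (suc n) ] ⟩
    stateCost (fullBins k ++ [ [ copiesLevel t (suc n) ] ]) ≡⟨ cong stateCost run ⟨
    stateCost (runFrom step [] (sortDesc I))                ∎
    where
    open ℕ.≤-Reasoning
    run : runFrom step [] (sortDesc I) ≡ fullBins k ++ [ [ copiesLevel t (suc n) ] ]
    run rewrite sortDesc-I | runFrom-++ step [] (replicate k 1ℚ) (replicate (suc n) t)
              | runFrom-units nextFit k = runFrom-copies nextFit 0<t k n fits

  placement : ∀ {j} → Block k j → Placement
  placement (first {j} _) = place (suc j) 0ℚ 0ℚ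
  placement (second m)    = place 0 (m · t) 0ℚ

  size : ∀ {j} → Block k j → ℚ
  size = blockwise 1ℚ t

  InUnitSquare : ℚ → Placement → Set
  InUnitSquare s p = (0ℚ ≤ℚ x p) × (x p +ℚ s ≤ℚ 1ℚ) × (0ℚ ≤ℚ y p) × (y p +ℚ s ≤ℚ 1ℚ)

  placement-inUnitSquare : ∀ {j} (b : Block k j) → j < k + suc n → InUnitSquare (size b) (placement b)
  placement-inUnitSquare (first _)  _   = ℚ.≤-refl , ℚ.≤-refl , ℚ.≤-refl , ℚ.≤-refl
  placement-inUnitSquare (second m) m<n =
    ·-nonNeg m 0≤t ,
    ℚ.≤-trans (m<n⇒m·x+x≤n·x 0≤t (ℕ.+-cancelˡ-< k m (suc n) m<n)) fits ,
    ℚ.≤-refl ,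
    subst (_≤ℚ 1ℚ) (sym (ℚ.+-identityˡ t)) t≤1

  placement-disjoint : ∀ {i j} (a : Block k i) (b : Block k j) → ¬ i ≡ j →
    bin (placement a) ≡ bin (placement b) → Disjoint (size a) (placement a) (size b) (placement b)
  placement-disjoint (first _)  (first _)   i≢j same = contradiction (ℕ.suc-injective same) i≢j
  placement-disjoint (second m) (second m′) i≢j same with ℕ.<-cmp m m′
  ... | tri< m<m′ _ _ = inj₁ (m<n⇒m·x+x≤n·x 0≤t m<m′)
  ... | tri≈ _ m≡m′ _ = contradiction (cong (k +_) m≡m′) i≢j
  ... | tri> _ _ m′<m = inj₂ (inj₁ (m<n⇒m·x+x≤n·x 0≤t m′<m))

  P : Packing I
  P i = placement (block k (toℕ i))

  length-I : length I ≡ k + suc n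
  length-I = trans (List.length-++ (replicate k 1ℚ))
                   (cong₂ _+_ (List.length-replicate k) (List.length-replicate (suc n)))

  lookup-I : ∀ i → lookup I i ≡ size (block k (toℕ i))
  lookup-I = lookup-replicate-++ k 1ℚ t (suc n)

  feasible : Feasible I P
  feasible = inUnitSquare , disjoint
    where
    inUnitSquare : ∀ i → InUnitSquare (lookup I i) (P i)
    inUnitSquare i = subst (λ s → InUnitSquare s (P i)) (sym (lookup-I i))
      (placement-inUnitSquare (block k (toℕ i)) (subst (toℕ i <_) length-I (Fin.toℕ<n i)))
    disjoint : ∀ i j → ¬ i ≡ j → bin (P i) ≡ bin (P j) →
               Disjoint (lookup I i) (P i) (lookup I j) (P j)
    disjoint i j i≢j same = subst₂ (λ s s′ → Disjoint s (P i) s′ (P j)) (sym (lookup-I i)) (sym (lookup-I j))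
      (placement-disjoint (block k (toℕ i)) (block k (toℕ j)) (i≢j ∘ Fin.toℕ-injective) same)

  itemCost : ℕ → ℕ
  itemCost j = suc (bin (placement (block k j)))

  itemCost≤ : ∀ j → itemCost j ≤ suc k
  itemCost≤ j with block k j
  ... | first j<k = s≤s j<k
  ... | second _  = s≤s z≤n

  itemCost-second : ∀ m → itemCost (k + m) ≤ 1
  itemCost-second m rewrite block-+ k m = ℕ.≤-refl

  optimal-cost : packingCost I P ≤ k * suc k + suc n * 1
  optimal-cost = begin
    packingCost I P
      ≡⟨ cong sum (map-∘toℕ-allFin (length I) itemCost) ⟩
    sum (applyUpTo itemCost (length I))
      ≡⟨ cong (sum ∘ applyUpTo itemCost) length-I ⟩
    sum (applyUpTo itemCost (k + suc n))
      ≡⟨ cong sum (applyUpTo-+ itemCost k (suc n)) ⟩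
    sum (applyUpTo itemCost k ++ applyUpTo (itemCost ∘ (k +_)) (suc n))
      ≡⟨ sum-++ (applyUpTo itemCost k) _ ⟩
    sum (applyUpTo itemCost k) + sum (applyUpTo (itemCost ∘ (k +_)) (suc n))
      ≤⟨ ℕ.+-mono-≤ (sum-applyUpTo-≤ itemCost k itemCost≤) (sum-applyUpTo-≤ _ (suc n) itemCost-second) ⟩
    k * suc k + suc n * 1
      ∎
    where open ℕ.≤-Reasoning

c*[a+m*1]<[1+c]*m : ∀ c a m → c * a < m → c * (a + m * 1) < suc c * m
c*[a+m*1]<[1+c]*m c a m ca<m = begin-strict
  c * (a + m * 1)   ≡⟨ cong (λ z → c * (a + z)) (ℕ.*-identityʳ m) ⟩
  c * (a + m)       ≡⟨ ℕ.*-distribˡ-+ c a m ⟩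
  c * a + c * m     <⟨ ℕ.+-monoˡ-< (c * m) ca<m ⟩
  m + c * m         ∎
  where open ℕ.≤-Reasoning

counterexample : ∀ {step} → NextFitOnFullBins step → (c : ℕ) →
  Σ (List ℚ) λ I → ValidInstance I × Σ (Packing I) λ P → Feasible I P ×
    (c * packingCost I P < stateCost (runFrom step [] (sortDesc I)))
counterexample nextFit c = I , valid , P , feasible , (begin-strict
    c * packingCost I P           ≤⟨ ℕ.*-monoʳ-≤ c optimal-cost ⟩
    c * (c * suc c + suc n * 1)   <⟨ c*[a+m*1]<[1+c]*m c (c * suc c) (suc n) (ℕ.n<1+n n) ⟩
    suc c * suc n                 ≤⟨ heuristic-cost nextFit ⟩
    _                             ∎)
  where
  n : ℕ
  n = c * (c * suc c)
  open HardInstance c n (1/suc-pos n) (ℚ.≤-reflexive (·-1/suc n))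
  open ℕ.≤-Reasoning

lemma1 :
    ((c : ℕ) → Σ (List ℚ) λ I → ValidInstance I ×
       Σ (Packing I) λ P → Feasible I P × (c * packingCost I P < NFDH I))
    × ((r : AFDHRule) (c : ℕ) → Σ (List ℚ) λ I → ValidInstance I ×
       Σ (Packing I) λ P → Feasible I P × (c * packingCost I P < AFDH r I))
lemma1 = counterexample nfdhStep-nextFit , λ r → counterexample (afdhStep-nextFit r)
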